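{- Given positive integers $t$, $\ell$ and $K$ with $K, \ell \geq 2$, there is a hypergraph $\mathcal{H}$ such that: $\mathcal{H}$ is $t$-intersecting; $\chi(\mathcal{H}, t+\ell) = K^{\binom{t+2\ell-4}{\ell-2}} + t + 2\ell - 4$; and $\chi(\mathcal{H}, t, \ell) \leq K^{\binom{2\ell-4}{\ell-2}} + 2\ell - 4$.
   Context: A hypergraph $\mathcal{H}$ consists of a finite vertex set $V(\mathcal{H})$ and a set of edges, each a subset of $V(\mathcal{H})$. A colouring is a function $V(\mathcal{H}) \to \mathbb{N}$; it uses $m$ colours if its image has size $m$. A colouring is $c$-strong if every edge $e$ contains vertices of at least $\min\{c, |e|\}$ distinct colours; $\chi(\mathcal{H}, c)$ is the smallest number of colours in a $c$-strong colouring. $\mathcal{H}$ is $t$-intersecting if $|e \cap f| \ge t$ for all edges $e,f$. For $S \subseteq V(\mathcal{H})$, the link $\mathcal{H}_S$ has vertex set $V(\mathcal{H}) \setminus S$ and edge set $\{e \setminus S : e \text{ an edge},\ S \subseteq e\}$. Define $\chi(\mathcal{H}, t, \ell) = \max\big(\{1\} \cup \{\chi(\mathcal{H}_S, \ell) : S \subseteq V(\mathcal{H}),\ |S| = t\}\big)$. -}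

module Defs where

open import Data.Nat using (ℕ; _≤_; _⊓_; _≟_)
open import Data.Fin using (Fin)
open import Data.Fin.Subset using (Subset; _∈_; _⊆_; _∩_; _─_; ∣_∣)
open import Data.Fin.Subset.Properties using (_∈?_; _⊆?_)
open import Relation.Binary.PropositionalEquality using (_≡_)
open import Data.List using (List; filter; map; length; deduplicate; allFin)
open import Data.List.Membership.Propositional using () renaming (_∈_ to _∈ₗ_)
open import Data.List.Relation.Unary.All using (All)
open import Data.Product using (Σ; _×_)

record Hypergraph (n : ℕ) : Set where
  constructor mkHypergraph
  field
    verts : Subset n
    edges : List (Subset n)
open Hypergraph public

WellFormed : ∀ {n} → Hypergraph n → Set
WellFormed H = All (λ e → e ⊆ verts H) (edges H)

elems : ∀ {n} → Subset n → List (Fin n)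
elems {n} A = filter (λ i → i ∈? A) (allFin n)

-- a colouring is a function V → ℕ (values outside V are irrelevant)
Colouring : ℕ → Set
Colouring n = Fin n → ℕ

coloursOn : ∀ {n} → Colouring n → Subset n → ℕ
coloursOn f A = length (deduplicate _≟_ (map f (elems A)))

numColours : ∀ {n} → Hypergraph n → Colouring n → ℕ
numColours H f = coloursOn f (verts H)

Strong : ∀ {n} → Hypergraph n → ℕ → Colouring n → Set
Strong H c f = ∀ e → e ∈ₗ edges H → c ⊓ ∣ e ∣ ≤ coloursOn f e

IsChi : ∀ {n} → Hypergraph n → ℕ → ℕ → Set
IsChi H c m =
  Σ (Colouring _) (λ f → Strong H c f × numColours H f ≡ m)
  × (∀ f → Strong H c f → m ≤ numColours H f)

Intersecting : ∀ {n} → ℕ → Hypergraph n → Set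
Intersecting t H = ∀ e f → e ∈ₗ edges H → f ∈ₗ edges H → t ≤ ∣ e ∩ f ∣

link : ∀ {n} → Hypergraph n → Subset n → Hypergraph n
link {n} H S = mkHypergraph (verts H ─ S)
  (map (λ e → e ─ S) (filter (λ e → S ⊆? e) (edges H)))

-- χ(H, t, ℓ) ≤ b, where χ(H,t,ℓ) = max({1} ∪ {χ(H_S, ℓ) : S ⊆ V(H), |S| = t})
ChiLinkLe : ∀ {n} → Hypergraph n → ℕ → ℕ → ℕ → Set
ChiLinkLe H t ℓ b =
  1 ≤ b × (∀ S → S ⊆ verts H → ∣ S ∣ ≡ t → ∀ m → IsChi (link H S) ℓ m → m ≤ b)

{-# OPTIONS --safe #-}
-- Write ℓ = L + 2 and m = t + 2L. The vertices are the words of length N = C(m, L) over an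
-- alphabet of size K, whose positions p index the L-subsets D p of a core of size m, together
-- with the core. For every position p and words x, y there is the edge {x, y} ∪ (core ∖ D p),
-- where y is left out when x and y agree at p.
--
-- Any two core parts share at least m − 2L = t vertices, so H is t-intersecting. Every edge
-- has at most t + ℓ vertices and every pair of vertices lies in an edge, so a (t + ℓ)-strong
-- colouring is injective and χ(H, t + ℓ) = K^N + m.
--
-- Let S be a t-set. If S contains no word, it contains t core vertices and leaves a 2L-set R of
-- the core; only positions p with D p ⊆ R occur in link edges, and colouring each word by its
-- restriction to these C(2L, L) positions, and R injectively, is strong with K^C(2L,L) + 2L
-- colours. An edge contains at most two words, so if S contains one or two words a link edge
-- keeps at most one word and 2L + 2 colours suffice, and with three or more the link is empty.
module Submission where

open import Defs
open import Data.Nat using (ℕ; zero; suc; _+_; _*_; _∸_; _^_; _≤_; _<_; z≤n; s≤s; >-nonZero)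
open import Data.Nat.Properties
open import Data.Nat.Combinatorics using (_C_; nCk+nC[k+1]≡[n+1]C[k+1])
open import Data.Nat.Solver using (module +-*-Solver)
open import Data.Product using (Σ; _×_; _,_; proj₁; proj₂; ∃-syntax)
open import Data.Product.Properties using (,-injective)
open import Data.Sum using (_⊎_; inj₁; inj₂; [_,_]′)
open import Data.Fin using (Fin; zero; suc; toℕ; fromℕ<; _↑ˡ_; _↑ʳ_; splitAt; combine; remQuot; funToFin; finToFun)
open import Data.Fin.Properties using (toℕ-injective; toℕ<n; splitAt-↑ˡ; splitAt-↑ʳ; remQuot-combine; funToFin-finToFin; ¬∀⟶∃¬) renaming (_≟_ to _≟ᶠ_)
open import Data.Fin.Subset using (Subset; inside; outside; _∈_; _∉_; _⊆_; _∩_; _∪_; _─_; _-_; ∁; ⊤; ⊥; ⁅_⁆; ∣_∣; Nonempty)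
open import Data.Fin.Subset.Properties using (_∈?_; _⊆?_; ∈⊤; ∉⊥; ∣⊤∣≡n; ∣⊥∣≡0; x∈⁅x⁆; x∈⁅y⁆⇒x≡y; ∣⁅x⁆∣≡1; p⊆q⇒∣p∣≤∣q∣; x∈p∩q⁺; x∈p∩q⁻; x∈p∪q⁺; x∈p∪q⁻; x∈∁p⇒x∉p; x∉p⇒x∈∁p; ∣∁p∣≡n∸∣p∣; p─q⊆p; x∈p∧x≢y⇒x∈p-y; x∈p⇒∣p-x∣<∣p∣; in⊆in; out⊆; drop-there; drop-∷-⊆; nonempty?; Empty-unique)
open import Data.Vec as Vec using (Vec; []; _∷_; _++_; lookup; here; there)
open import Data.Vec.Properties using (zipWith-++; map-++; map-∘; map-const; lookup-map; lookup-++ˡ; lookup-++ʳ; lookup⇒[]=; []=⇒lookup)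
import Data.Vec.Relation.Unary.All as VecAll
import Data.Vec.Relation.Unary.All.Properties as VecAllₚ
import Data.Vec.Relation.Unary.Any as VecAny
import Data.Vec.Relation.Unary.Any.Properties as VecAnyₚ
open import Data.List as List using (List; []; _∷_; filter; tabulate; length; deduplicate; allFin; applyUpTo; cartesianProduct)
open import Data.List.Properties using (filter-notAll; filter-accept; filter-reject; length-map; length-++; length-applyUpTo)
open import Data.List.Membership.Propositional using () renaming (_∈_ to _∈ₗ_)
open import Data.List.Membership.Propositional.Properties using (∈-filter⁺; ∈-filter⁻; ∈-map⁺; ∈-map⁻; ∈-allFin; ∈-deduplicate⁺; ∈-deduplicate⁻; ∈-applyUpTo⁺; ∈-cartesianProduct⁺; ∈-++⁺ˡ; ∈-++⁺ʳ)
open import Data.List.Relation.Binary.Subset.Propositional using () renaming (_⊆_ to _⊆ₗ_)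
open import Data.List.Relation.Unary.Any as Any using (here; there)
import Data.List.Relation.Unary.All as All
open import Data.List.Relation.Unary.AllPairs using ([]; _∷_)
open import Data.List.Relation.Unary.Unique.Propositional using (Unique)
import Data.List.Relation.Unary.Unique.Propositional.Properties as Uniqueₚ
open import Data.List.Relation.Unary.Unique.DecPropositional.Properties using (deduplicate-!)
open import Function using (_∘_)
open import Relation.Binary.Definitions using (DecidableEquality)
open import Relation.Binary.PropositionalEquality using (_≡_; _≢_; _≗_; refl; sym; trans; cong; cong₂; subst; module ≡-Reasoning)
open import Relation.Nullary using (¬_; yes; no; ¬?; does; contradiction)
open import Relation.Nullary.Decidable using (dec-true)

-- Counting colours

module _ {A : Set} (_≟ᴬ_ : DecidableEquality A) where

  unique-⊆⇒length≤ : ∀ {xs ys : List A} → Unique xs → xs ⊆ₗ ys → length xs ≤ length ys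
  unique-⊆⇒length≤ {[]} _ _ = z≤n
  unique-⊆⇒length≤ {x ∷ xs} {ys} (x∉xs ∷ xs!) x∷xs⊆ys =
    ≤-trans (s≤s (unique-⊆⇒length≤ xs! xs⊆ys-x)) (filter-notAll (¬? ∘ (x ≟ᴬ_)) ys x∈ys)
    where
    xs⊆ys-x : xs ⊆ₗ filter (¬? ∘ (x ≟ᴬ_)) ys
    xs⊆ys-x z∈xs = ∈-filter⁺ (¬? ∘ (x ≟ᴬ_)) (x∷xs⊆ys (there z∈xs)) (All.lookup x∉xs z∈xs)
    x∈ys : Any.Any (λ y → ¬ ¬ x ≡ y) ys
    x∈ys = Any.map (λ x≡y x≢y → x≢y x≡y) (x∷xs⊆ys (here refl))

∈-elems⁺ : ∀ {n} {A : Subset n} {i} → i ∈ A → i ∈ₗ elems A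
∈-elems⁺ {A = A} {i} i∈A = ∈-filter⁺ (_∈? A) (∈-allFin i) i∈A

∈-elems⁻ : ∀ {n} {A : Subset n} {i} → i ∈ₗ elems A → i ∈ A
∈-elems⁻ {n} {A} i∈ = proj₂ (∈-filter⁻ (_∈? A) {xs = allFin n} i∈)

elems-unique : ∀ {n} (A : Subset n) → Unique (elems A)
elems-unique {n} A = Uniqueₚ.filter⁺ (_∈? A) (Uniqueₚ.allFin⁺ n)

length-filter-tabulate : ∀ {n k} (A : Subset n) {B : Subset k} (f : Fin n → Fin k) →
  (∀ {i} → f i ∈ B → i ∈ A) → (∀ {i} → i ∈ A → f i ∈ B) →
  length (filter (_∈? B) (tabulate f)) ≡ ∣ A ∣
length-filter-tabulate [] f _ _ = refl
length-filter-tabulate (inside ∷ A) {B} f from to =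
  trans (cong length (filter-accept (_∈? B) (to here)))
    (cong suc (length-filter-tabulate A (f ∘ suc) (drop-there ∘ from) (to ∘ there)))
length-filter-tabulate (outside ∷ A) {B} f from to =
  trans (cong length (filter-reject (_∈? B) (λ f0∈B → contradiction (from f0∈B) λ ())))
    (length-filter-tabulate A (f ∘ suc) (drop-there ∘ from) (to ∘ there))

length-elems : ∀ {n} (A : Subset n) → length (elems A) ≡ ∣ A ∣
length-elems A = length-filter-tabulate A (λ i → i) (λ i∈A → i∈A) (λ i∈A → i∈A)

InjectiveOn : ∀ {n} → Colouring n → Subset n → Set
InjectiveOn g A = ∀ {u v} → u ∈ A → v ∈ A → g u ≡ g v → u ≡ v

module _ {n} (g : Colouring n) where

  length-image : ∀ (A : Subset n) → length (List.map g (elems A)) ≡ ∣ A ∣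
  length-image A = trans (length-map g (elems A)) (length-elems A)

  coloursOn≤length : ∀ {A} (Y : List ℕ) → (∀ {v} → v ∈ A → g v ∈ₗ Y) → coloursOn g A ≤ length Y
  coloursOn≤length {A} Y g[A]⊆Y =
    unique-⊆⇒length≤ _≟_ (deduplicate-! _≟_ (List.map g (elems A))) (image⊆Y ∘ ∈-deduplicate⁻ _≟_ _)
    where
    image⊆Y : List.map g (elems A) ⊆ₗ Y
    image⊆Y c∈ with v , v∈ , refl ← ∈-map⁻ g c∈ = g[A]⊆Y (∈-elems⁻ v∈)

  coloursOn≤∣∣ : ∀ (A : Subset n) → coloursOn g A ≤ ∣ A ∣
  coloursOn≤∣∣ A = subst (coloursOn g A ≤_) (length-image A)
    (coloursOn≤length (List.map g (elems A)) (∈-map⁺ g ∘ ∈-elems⁺))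

  injectiveOn⇒∣∣≤coloursOn : ∀ {A} → InjectiveOn g A → ∣ A ∣ ≤ coloursOn g A
  injectiveOn⇒∣∣≤coloursOn {A} inj = subst (_≤ coloursOn g A) (length-image A)
    (unique-⊆⇒length≤ _≟_ (map-unique (elems-unique A) (λ u∈ v∈ → inj (∈-elems⁻ u∈) (∈-elems⁻ v∈)))
      (∈-deduplicate⁺ _≟_))
    where
    map-unique : ∀ {xs} → Unique xs → (∀ {u v} → u ∈ₗ xs → v ∈ₗ xs → g u ≡ g v → u ≡ v) →
      Unique (List.map g xs)
    map-unique {[]} _ _ = []
    map-unique {x ∷ xs} (x∉xs ∷ xs!) inj-xs =
      All.tabulate fresh ∷ map-unique xs! (λ u∈ v∈ → inj-xs (there u∈) (there v∈))
      where
      fresh : ∀ {c} → c ∈ₗ List.map g xs → g x ≢ c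
      fresh c∈ gx≡c with y , y∈ , refl ← ∈-map⁻ g c∈ =
        All.lookup x∉xs y∈ (inj-xs (here refl) (there y∈) gx≡c)

  -- If g u ≡ g v for some u ≢ v, every colour of A already occurs on A - v.
  ∣∣≤coloursOn⇒injectiveOn : ∀ {A} → ∣ A ∣ ≤ coloursOn g A → InjectiveOn g A
  ∣∣≤coloursOn⇒injectiveOn {A} full {u} {v} u∈A v∈A gu≡gv with u ≟ᶠ v
  ... | yes u≡v = u≡v
  ... | no u≢v = contradiction (x∈p⇒∣p-x∣<∣p∣ v∈A) (≤⇒≯ (≤-trans full few))
    where
    few : coloursOn g A ≤ ∣ A - v ∣
    few = subst (coloursOn g A ≤_) (length-image (A - v)) (coloursOn≤length _ colour∈)
      where
      colour∈ : ∀ {w} → w ∈ A → g w ∈ₗ List.map g (elems (A - v))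
      colour∈ {w} w∈A with w ≟ᶠ v
      ... | yes w≡v = subst (_∈ₗ List.map g (elems (A - v))) (trans gu≡gv (cong g (sym w≡v)))
        (∈-map⁺ g (∈-elems⁺ (x∈p∧x≢y⇒x∈p-y u∈A u≢v)))
      ... | no w≢v = ∈-map⁺ g (∈-elems⁺ (x∈p∧x≢y⇒x∈p-y w∈A w≢v))

-- Subsets of Fin n and of Fin (a + b)

x∈p⇒0<∣p∣ : ∀ {n} {p : Subset n} {x} → x ∈ p → 0 < ∣ p ∣
x∈p⇒0<∣p∣ {p = p} {x} x∈p = subst (_≤ ∣ p ∣) (∣⁅x⁆∣≡1 x) (p⊆q⇒∣p∣≤∣q∣ ⁅x⁆⊆p)
  where
  ⁅x⁆⊆p : ⁅ x ⁆ ⊆ p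
  ⁅x⁆⊆p y∈⁅x⁆ = subst (_∈ p) (sym (x∈⁅y⁆⇒x≡y x y∈⁅x⁆)) x∈p

0<∣p∣⇒nonempty : ∀ {n} {p : Subset n} → 0 < ∣ p ∣ → Nonempty p
0<∣p∣⇒nonempty {n} {p} 0<∣p∣ with nonempty? p
... | yes p≢∅ = p≢∅
... | no p≡∅ = contradiction (trans (cong ∣_∣ (Empty-unique p≡∅)) (∣⊥∣≡0 n)) (>⇒≢ 0<∣p∣)

∣p∣≤1⇒x≡y : ∀ {n} {p : Subset n} {x y} → ∣ p ∣ ≤ 1 → x ∈ p → y ∈ p → x ≡ y
∣p∣≤1⇒x≡y {p = p} {x} {y} ∣p∣≤1 x∈p y∈p with x ≟ᶠ y
... | yes x≡y = x≡y
... | no x≢y = contradiction ∣p∣≤1 (<⇒≱ (≤-trans (s≤s (x∈p⇒0<∣p∣ y∈p-x)) (x∈p⇒∣p-x∣<∣p∣ x∈p)))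
  where
  y∈p-x : y ∈ p - x
  y∈p-x = x∈p∧x≢y⇒x∈p-y y∈p (x≢y ∘ sym)

x∈⁅y⁆∪⁅z⁆⇒x≡y⊎x≡z : ∀ {n} {x y z : Fin n} → x ∈ ⁅ y ⁆ ∪ ⁅ z ⁆ → x ≡ y ⊎ x ≡ z
x∈⁅y⁆∪⁅z⁆⇒x≡y⊎x≡z {y = y} {z} x∈ with x∈p∪q⁻ ⁅ y ⁆ ⁅ z ⁆ x∈
... | inj₁ x∈⁅y⁆ = inj₁ (x∈⁅y⁆⇒x≡y y x∈⁅y⁆)
... | inj₂ x∈⁅z⁆ = inj₂ (x∈⁅y⁆⇒x≡y z x∈⁅z⁆)

x∈p─q⇒x∉q : ∀ {n} (p q : Subset n) {x} → x ∈ p ─ q → x ∉ q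
x∈p─q⇒x∉q (_ ∷ p) (inside ∷ q) {zero} ()
x∈p─q⇒x∉q (_ ∷ p) (outside ∷ q) {zero} _ ()
x∈p─q⇒x∉q (_ ∷ p) (_ ∷ q) {suc x} x∈p─q x∈q = x∈p─q⇒x∉q p q (drop-there x∈p─q) (drop-there x∈q)

∣p─q∣+∣q∣≡∣p∣ : ∀ {n} {p q : Subset n} → q ⊆ p → ∣ p ─ q ∣ + ∣ q ∣ ≡ ∣ p ∣
∣p─q∣+∣q∣≡∣p∣ {p = []} {[]} _ = refl
∣p─q∣+∣q∣≡∣p∣ {p = inside ∷ p} {inside ∷ q} q⊆p = trans (+-suc _ _) (cong suc (∣p─q∣+∣q∣≡∣p∣ (drop-∷-⊆ q⊆p)))
∣p─q∣+∣q∣≡∣p∣ {p = inside ∷ p} {outside ∷ q} q⊆p = cong suc (∣p─q∣+∣q∣≡∣p∣ (drop-∷-⊆ q⊆p))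
∣p─q∣+∣q∣≡∣p∣ {p = outside ∷ p} {inside ∷ q} q⊆p = contradiction (q⊆p here) λ ()
∣p─q∣+∣q∣≡∣p∣ {p = outside ∷ p} {outside ∷ q} q⊆p = ∣p─q∣+∣q∣≡∣p∣ (drop-∷-⊆ q⊆p)

∣p∪q∣≤∣p∣+∣q∣ : ∀ {n} (p q : Subset n) → ∣ p ∪ q ∣ ≤ ∣ p ∣ + ∣ q ∣
∣p∪q∣≤∣p∣+∣q∣ [] [] = z≤n
∣p∪q∣≤∣p∣+∣q∣ (inside ∷ p) (inside ∷ q) =
  s≤s (≤-trans (∣p∪q∣≤∣p∣+∣q∣ p q) (≤-trans (n≤1+n _) (≤-reflexive (sym (+-suc _ _)))))
∣p∪q∣≤∣p∣+∣q∣ (inside ∷ p) (outside ∷ q) = s≤s (∣p∪q∣≤∣p∣+∣q∣ p q)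
∣p∪q∣≤∣p∣+∣q∣ (outside ∷ p) (inside ∷ q) = ≤-trans (s≤s (∣p∪q∣≤∣p∣+∣q∣ p q)) (≤-reflexive (sym (+-suc _ _)))
∣p∪q∣≤∣p∣+∣q∣ (outside ∷ p) (outside ∷ q) = ∣p∪q∣≤∣p∣+∣q∣ p q

n∸[∣p∣+∣q∣]≤∣∁p∩∁q∣ : ∀ {n} (p q : Subset n) → n ∸ (∣ p ∣ + ∣ q ∣) ≤ ∣ ∁ p ∩ ∁ q ∣
n∸[∣p∣+∣q∣]≤∣∁p∩∁q∣ {n} p q = begin
  n ∸ (∣ p ∣ + ∣ q ∣) ≤⟨ ∸-monoʳ-≤ n (∣p∪q∣≤∣p∣+∣q∣ p q) ⟩
  n ∸ ∣ p ∪ q ∣       ≡⟨ ∣∁p∣≡n∸∣p∣ (p ∪ q) ⟨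
  ∣ ∁ (p ∪ q) ∣       ≤⟨ p⊆q⇒∣p∣≤∣q∣ ∁[p∪q]⊆∁p∩∁q ⟩
  ∣ ∁ p ∩ ∁ q ∣       ∎
  where
  open ≤-Reasoning
  ∁[p∪q]⊆∁p∩∁q : ∁ (p ∪ q) ⊆ ∁ p ∩ ∁ q
  ∁[p∪q]⊆∁p∩∁q x∈ = x∈p∩q⁺ ( x∉p⇒x∈∁p (x∈∁p⇒x∉p x∈ ∘ x∈p∪q⁺ ∘ inj₁)
                          , x∉p⇒x∈∁p (x∈∁p⇒x∉p x∈ ∘ x∈p∪q⁺ ∘ inj₂))

data Split (a b : ℕ) : Fin (a + b) → Set where
  left  : (i : Fin a) → Split a b (i ↑ˡ b)
  right : (j : Fin b) → Split a b (a ↑ʳ j)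

split : ∀ a b (v : Fin (a + b)) → Split a b v
split zero    b v = right v
split (suc a) b zero = left zero
split (suc a) b (suc v) with split a b v
... | left i  = left (suc i)
... | right j = right j

module _ {a b} {A : Subset a} {B : Subset b} where

  ↑ˡ∈++⁺ : ∀ {i} → i ∈ A → (i ↑ˡ b) ∈ A ++ B
  ↑ˡ∈++⁺ {i} i∈A = lookup⇒[]= _ (A ++ B) (trans (lookup-++ˡ A B i) ([]=⇒lookup i∈A))

  ↑ˡ∈++⁻ : ∀ {i} → (i ↑ˡ b) ∈ A ++ B → i ∈ A
  ↑ˡ∈++⁻ {i} i∈A++B = lookup⇒[]= i A (trans (sym (lookup-++ˡ A B i)) ([]=⇒lookup i∈A++B))

  ↑ʳ∈++⁺ : ∀ {j} → j ∈ B → (a ↑ʳ j) ∈ A ++ B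
  ↑ʳ∈++⁺ {j} j∈B = lookup⇒[]= _ (A ++ B) (trans (lookup-++ʳ A B j) ([]=⇒lookup j∈B))

  ↑ʳ∈++⁻ : ∀ {j} → (a ↑ʳ j) ∈ A ++ B → j ∈ B
  ↑ʳ∈++⁻ {j} j∈A++B = lookup⇒[]= j B (trans (sym (lookup-++ʳ A B j)) ([]=⇒lookup j∈A++B))

⊆-++⁻ : ∀ {a b} {A A′ : Subset a} {B B′ : Subset b} → A ++ B ⊆ A′ ++ B′ → A ⊆ A′ × B ⊆ B′
⊆-++⁻ A++B⊆A′++B′ = ↑ˡ∈++⁻ ∘ A++B⊆A′++B′ ∘ ↑ˡ∈++⁺ , ↑ʳ∈++⁻ ∘ A++B⊆A′++B′ ∘ ↑ʳ∈++⁺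

∣++∣ : ∀ {a b} (A : Subset a) (B : Subset b) → ∣ A ++ B ∣ ≡ ∣ A ∣ + ∣ B ∣
∣++∣ [] B = refl
∣++∣ (inside ∷ A) B = cong suc (∣++∣ A B)
∣++∣ (outside ∷ A) B = ∣++∣ A B

++-─ : ∀ {a b} (A A′ : Subset a) (B B′ : Subset b) → (A ++ B) ─ (A′ ++ B′) ≡ (A ─ A′) ++ (B ─ B′)
++-─ A A′ B B′ = zipWith-++ _ A B A′ B′

++-∩ : ∀ {a b} (A A′ : Subset a) (B B′ : Subset b) → (A ++ B) ∩ (A′ ++ B′) ≡ (A ∩ A′) ++ (B ∩ B′)
++-∩ A A′ B B′ = zipWith-++ _ A B A′ B′

infixr 5 _⊕_
_⊕_ : ∀ {a b} → Colouring a → Colouring b → Colouring (a + b)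
_⊕_ {a} f g v = [ f , g ]′ (splitAt a v)

module _ {a b} (f : Colouring a) (g : Colouring b) where

  ⊕-↑ˡ : ∀ i → (f ⊕ g) (i ↑ˡ b) ≡ f i
  ⊕-↑ˡ i = cong [ f , g ]′ (splitAt-↑ˡ a i b)

  ⊕-↑ʳ : ∀ j → (f ⊕ g) (a ↑ʳ j) ≡ g j
  ⊕-↑ʳ j = cong [ f , g ]′ (splitAt-↑ʳ a b j)

  ⊕-injectiveOn : ∀ {A B} → InjectiveOn f A → InjectiveOn g B →
    (∀ {i j} → i ∈ A → j ∈ B → f i ≢ g j) → InjectiveOn (f ⊕ g) (A ++ B)
  ⊕-injectiveOn f-inj g-inj separated {u} {v} u∈ v∈ same with split a b u | split a b v
  ... | left i  | left i′  = cong (_↑ˡ b) (f-inj (↑ˡ∈++⁻ u∈) (↑ˡ∈++⁻ v∈) (trans (sym (⊕-↑ˡ i)) (trans same (⊕-↑ˡ i′))))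
  ... | right j | right j′ = cong (a ↑ʳ_) (g-inj (↑ʳ∈++⁻ u∈) (↑ʳ∈++⁻ v∈) (trans (sym (⊕-↑ʳ j)) (trans same (⊕-↑ʳ j′))))
  ... | left i  | right j  =
    contradiction (trans (sym (⊕-↑ˡ i)) (trans same (⊕-↑ʳ j))) (separated (↑ˡ∈++⁻ u∈) (↑ʳ∈++⁻ v∈))
  ... | right j | left i   =
    contradiction (trans (sym (⊕-↑ˡ i)) (trans (sym same) (⊕-↑ʳ j))) (separated (↑ˡ∈++⁻ v∈) (↑ʳ∈++⁻ u∈))

  coloursOn-⊕≤length : ∀ {A} (Y : List ℕ) → (∀ {i} → (i ↑ˡ b) ∈ A → f i ∈ₗ Y) →
    (∀ {j} → (a ↑ʳ j) ∈ A → g j ∈ₗ Y) → coloursOn (f ⊕ g) A ≤ length Y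
  coloursOn-⊕≤length Y f∈Y g∈Y = coloursOn≤length (f ⊕ g) Y colour∈Y
    where
    colour∈Y : ∀ {v} → v ∈ _ → (f ⊕ g) v ∈ₗ Y
    colour∈Y {v} v∈A with split a b v
    ... | left i  = subst (_∈ₗ Y) (sym (⊕-↑ˡ i)) (f∈Y v∈A)
    ... | right j = subst (_∈ₗ Y) (sym (⊕-↑ʳ j)) (g∈Y v∈A)

-- Strong colourings

module _ {n} (H : Hypergraph n) where

  strong⇒injectiveOn : ∀ {c g e} → Strong H c g → e ∈ₗ edges H → ∣ e ∣ ≤ c → InjectiveOn g e
  strong⇒injectiveOn {c} {g} {e} strong e∈H ∣e∣≤c =
    ∣∣≤coloursOn⇒injectiveOn g (subst (_≤ coloursOn g e) (m≥n⇒m⊓n≡n ∣e∣≤c) (strong e e∈H))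

  injectiveOn⇒strong : ∀ {c g} → (∀ {e} → e ∈ₗ edges H → InjectiveOn g e) → Strong H c g
  injectiveOn⇒strong {c} {g} inj e e∈H = ≤-trans (m⊓n≤n c ∣ e ∣) (injectiveOn⇒∣∣≤coloursOn g (inj e∈H))

link-strong : ∀ {n} (H : Hypergraph n) {S c g} → (∀ {e} → e ∈ₗ edges H → S ⊆ e → InjectiveOn g (e ─ S)) →
  Strong (link H S) c g
link-strong H {S} {g = g} inj = injectiveOn⇒strong (link H S) inj-link
  where
  inj-link : ∀ {e} → e ∈ₗ edges (link H S) → InjectiveOn g e
  inj-link e∈ with e₀ , e₀∈ , refl ← ∈-map⁻ (_─ S) e∈ =
    let e₀∈H , S⊆e₀ = ∈-filter⁻ (S ⊆?_) e₀∈ in inj e₀∈H S⊆e₀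

chiLinkLe-intro : ∀ {n} (H : Hypergraph n) {t ℓ b} → 1 ≤ b →
  (∀ S → ∣ S ∣ ≡ t → ∃[ g ] Strong (link H S) ℓ g × numColours (link H S) g ≤ b) → ChiLinkLe H t ℓ b
chiLinkLe-intro H 1≤b colouring = 1≤b , λ S _ ∣S∣≡t _ χ →
  let (g , strong , few) = colouring S ∣S∣≡t in ≤-trans (proj₂ χ g strong) few

CoversPairs : ∀ {n} → List (Subset n) → Set
CoversPairs E = ∀ {u v} → u ≢ v → ∃[ e ] e ∈ₗ E × u ∈ e × v ∈ e

isChi-covering : ∀ {n c} (E : List (Subset n)) → (∀ {e} → e ∈ₗ E → ∣ e ∣ ≤ c) → CoversPairs E →
  IsChi (mkHypergraph ⊤ E) c n
isChi-covering {n} {c} E small covers = (toℕ , toℕ-strong , toℕ-colours) , λ _ → n≤numColours ∘ strong⇒injective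
  where
  H = mkHypergraph ⊤ E

  toℕ-injectiveOn : ∀ {A} → InjectiveOn toℕ A
  toℕ-injectiveOn _ _ = toℕ-injective

  toℕ-strong : Strong H c toℕ
  toℕ-strong = injectiveOn⇒strong H (λ _ → toℕ-injectiveOn)

  strong⇒injective : ∀ {g} → Strong H c g → InjectiveOn g ⊤
  strong⇒injective strong {u} {v} _ _ gu≡gv with u ≟ᶠ v
  ... | yes u≡v = u≡v
  ... | no u≢v with e , e∈E , u∈e , v∈e ← covers u≢v = strong⇒injectiveOn H strong e∈E (small e∈E) u∈e v∈e gu≡gv

  n≤numColours : ∀ {g} → InjectiveOn g ⊤ → n ≤ numColours H g
  n≤numColours {g} inj = subst (_≤ numColours H g) (∣⊤∣≡n n) (injectiveOn⇒∣∣≤coloursOn g inj)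

  toℕ-colours : numColours H toℕ ≡ n
  toℕ-colours = ≤-antisym (subst (numColours H toℕ ≤_) (∣⊤∣≡n n) (coloursOn≤∣∣ toℕ (⊤ {n})))
                          (n≤numColours toℕ-injectiveOn)

-- The k-subsets of Fin m

-- Pascal's rule, which builds subsetsOfSize; _C_ itself is defined through factorials.
binomial : ℕ → ℕ → ℕ
binomial _       zero    = 1
binomial zero    (suc k) = 0
binomial (suc m) (suc k) = binomial m k + binomial m (suc k)

binomial≡C : ∀ m k → binomial m k ≡ m C k
binomial≡C m       zero    = refl
binomial≡C zero    (suc k) = refl
binomial≡C (suc m) (suc k) =
  trans (cong₂ _+_ (binomial≡C m k) (binomial≡C m (suc k))) (nCk+nC[k+1]≡[n+1]C[k+1] m k)

0<binomial : ∀ {m k} → k ≤ m → 0 < binomial m k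
0<binomial {k = zero} _ = s≤s z≤n
0<binomial {suc m} {suc k} (s≤s k≤m) = ≤-trans (0<binomial k≤m) (m≤m+n _ _)

subsetsOfSize : ∀ m k → Vec (Subset m) (binomial m k)
subsetsOfSize m       zero    = ⊥ ∷ []
subsetsOfSize zero    (suc k) = []
subsetsOfSize (suc m) (suc k) =
  Vec.map (inside ∷_) (subsetsOfSize m k) ++ Vec.map (outside ∷_) (subsetsOfSize m (suc k))

∣subsetsOfSize∣ : ∀ m k → VecAll.All (λ D → ∣ D ∣ ≡ k) (subsetsOfSize m k)
∣subsetsOfSize∣ m       zero    = ∣⊥∣≡0 m VecAll.∷ VecAll.[]
∣subsetsOfSize∣ zero    (suc k) = VecAll.[]
∣subsetsOfSize∣ (suc m) (suc k) =
  VecAllₚ.++⁺ (VecAllₚ.map⁺ (VecAll.map (cong suc) (∣subsetsOfSize∣ m k)))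
              (VecAllₚ.map⁺ (∣subsetsOfSize∣ m (suc k)))

subsetsOfSize-complete : ∀ {m k} {A : Subset m} → k ≤ ∣ A ∣ → VecAny.Any (_⊆ A) (subsetsOfSize m k)
subsetsOfSize-complete {k = zero} _ = VecAny.here (λ x∈⊥ → contradiction x∈⊥ ∉⊥)
subsetsOfSize-complete {suc m} {suc k} {inside ∷ A} (s≤s k≤∣A∣) =
  VecAnyₚ.++⁺ˡ (VecAnyₚ.map⁺ (VecAny.map in⊆in (subsetsOfSize-complete k≤∣A∣)))
subsetsOfSize-complete {suc m} {suc k} {outside ∷ A} k<∣A∣ =
  VecAnyₚ.++⁺ʳ _ (VecAnyₚ.map⁺ (VecAny.map out⊆ (subsetsOfSize-complete k<∣A∣)))

positionsWithin : ∀ {m q} → Subset m → Vec (Subset m) q → Subset q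
positionsWithin R = Vec.map (λ D → does (D ⊆? R))

∈-positionsWithin⁺ : ∀ {m q} {R : Subset m} (Ds : Vec (Subset m) q) {p} →
  lookup Ds p ⊆ R → p ∈ positionsWithin R Ds
∈-positionsWithin⁺ {R = R} Ds {p} Dp⊆R =
  lookup⇒[]= p _ (trans (lookup-map p _ Ds) (dec-true (lookup Ds p ⊆? R) Dp⊆R))

∣positionsWithin-++∣ : ∀ {m a b} {R : Subset m} (xs : Vec (Subset m) a) (ys : Vec (Subset m) b) →
  ∣ positionsWithin R (xs ++ ys) ∣ ≡ ∣ positionsWithin R xs ∣ + ∣ positionsWithin R ys ∣
∣positionsWithin-++∣ {R = R} xs ys =
  trans (cong ∣_∣ (map-++ _ xs ys)) (∣++∣ (positionsWithin R xs) (positionsWithin R ys))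

positionsWithin-map : ∀ {m m′ q} (R : Subset m) (f : Subset m′ → Subset m) (Ds : Vec (Subset m′) q) →
  positionsWithin R (Vec.map f Ds) ≡ Vec.map (λ D → does (f D ⊆? R)) Ds
positionsWithin-map R f Ds = sym (map-∘ (λ D → does (D ⊆? R)) f Ds)

∣positionsWithin∣ : ∀ m k (R : Subset m) → ∣ positionsWithin R (subsetsOfSize m k) ∣ ≡ binomial ∣ R ∣ k
∣positionsWithin∣ m zero R rewrite dec-true (⊥ ⊆? R) (λ x∈⊥ → contradiction x∈⊥ ∉⊥) = refl
∣positionsWithin∣ zero (suc k) [] = refl
∣positionsWithin∣ (suc m) (suc k) (inside ∷ R) = begin
    (∣ positionsWithin (inside ∷ R) (ins ++ outs) ∣)
  ≡⟨ ∣positionsWithin-++∣ ins outs ⟩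
    (∣ positionsWithin (inside ∷ R) ins ∣) + (∣ positionsWithin (inside ∷ R) outs ∣)
  ≡⟨ cong₂ (λ P Q → (∣ P ∣) + (∣ Q ∣)) (positionsWithin-map _ (inside ∷_) (subsetsOfSize m k))
                                       (positionsWithin-map _ (outside ∷_) (subsetsOfSize m (suc k))) ⟩
    (∣ positionsWithin R (subsetsOfSize m k) ∣) + (∣ positionsWithin R (subsetsOfSize m (suc k)) ∣)
  ≡⟨ cong₂ _+_ (∣positionsWithin∣ m k R) (∣positionsWithin∣ m (suc k) R) ⟩
    binomial (∣ R ∣) k + binomial (∣ R ∣) (suc k)
  ∎
  where
  open ≡-Reasoning
  ins = Vec.map (inside ∷_) (subsetsOfSize m k)
  outs = Vec.map (outside ∷_) (subsetsOfSize m (suc k))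
∣positionsWithin∣ (suc m) (suc k) (outside ∷ R) = begin
    (∣ positionsWithin (outside ∷ R) (ins ++ outs) ∣)
  ≡⟨ ∣positionsWithin-++∣ ins outs ⟩
    (∣ positionsWithin (outside ∷ R) ins ∣) + (∣ positionsWithin (outside ∷ R) outs ∣)
  ≡⟨ cong₂ (λ P Q → (∣ P ∣) + (∣ Q ∣))
       (trans (positionsWithin-map _ (inside ∷_) (subsetsOfSize m k)) (map-const (subsetsOfSize m k) outside))
       (positionsWithin-map _ (outside ∷_) (subsetsOfSize m (suc k))) ⟩
    (∣ ⊥ {binomial m k} ∣) + (∣ positionsWithin R (subsetsOfSize m (suc k)) ∣)
  ≡⟨ cong₂ _+_ (∣⊥∣≡0 (binomial m k)) (∣positionsWithin∣ m (suc k) R) ⟩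
    binomial (∣ R ∣) (suc k)
  ∎
  where
  open ≡-Reasoning
  ins = Vec.map (inside ∷_) (subsetsOfSize m k)
  outs = Vec.map (outside ∷_) (subsetsOfSize m (suc k))

-- Words over the alphabet Fin K

combine-injective : ∀ {a b} {i i′ : Fin a} {j j′ : Fin b} → combine i j ≡ combine i′ j′ → i ≡ i′ × j ≡ j′
combine-injective {b = b} {i} {i′} {j} {j′} eq =
  ,-injective (trans (sym (remQuot-combine i j)) (trans (cong (remQuot b) eq) (remQuot-combine i′ j′)))

funToFin-cong : ∀ {a b} {f g : Fin a → Fin b} → f ≗ g → funToFin f ≡ funToFin g
funToFin-cong {zero}  _   = refl
funToFin-cong {suc a} f≗g = cong₂ combine (f≗g zero) (funToFin-cong (f≗g ∘ suc))

finToFun-≢ : ∀ {K N} {x y : Fin (K ^ N)} → x ≢ y → ∃[ p ] finToFun x p ≢ finToFun y p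
finToFun-≢ {K} {N} {x} {y} x≢y = ¬∀⟶∃¬ N _ (λ p → finToFun x p ≟ᶠ finToFun y p) (x≢y ∘ same-digits)
  where
  same-digits : finToFun x ≗ finToFun y → x ≡ y
  same-digits x≗y =
    trans (sym (funToFin-finToFin {N} {K} x)) (trans (funToFin-cong x≗y) (funToFin-finToFin {N} {K} y))

-- The restriction of a word to the positions in P, packed into a number as funToFin does.
encodeOn : ∀ {K n} (P : Subset n) → (Fin n → Fin K) → Fin (K ^ ∣ P ∣)
encodeOn []            w = zero
encodeOn (inside ∷ P)  w = combine (w zero) (encodeOn P (w ∘ suc))
encodeOn (outside ∷ P) w = encodeOn P (w ∘ suc)

encodeOn-injective : ∀ {K n} {P : Subset n} {w w′ : Fin n → Fin K} →
  encodeOn P w ≡ encodeOn P w′ → ∀ {i} → i ∈ P → w i ≡ w′ i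
encodeOn-injective {K} {P = inside ∷ P} same here = proj₁ (combine-injective {K} same)
encodeOn-injective {K} {P = inside ∷ P} same (there i∈P) =
  encodeOn-injective (proj₂ (combine-injective {K} same)) i∈P
encodeOn-injective {P = outside ∷ P} same (there i∈P) = encodeOn-injective same i∈P

L≤t+L+L∸2 : ∀ {t} L → 1 ≤ t → L ≤ t + L + L ∸ 2
L≤t+L+L∸2 zero    _   = z≤n
L≤t+L+L∸2 {t} (suc L) 1≤t = m+n≤o⇒m≤o∸n (suc L)
  (subst (_≤ t + suc L + suc L) (+-comm 2 (suc L)) (+-monoˡ-≤ (suc L) (+-mono-≤ 1≤t (s≤s z≤n))))

t+L+L≡t+2*[2+L]∸4 : ∀ t L → t + L + L ≡ t + 2 * (2 + L) ∸ 4
t+L+L≡t+2*[2+L]∸4 t L = sym (trans (cong (_∸ 4) expand) (m+n∸n≡m (t + L + L) 4))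
  where
  open +-*-Solver
  expand : t + 2 * (2 + L) ≡ t + L + L + 4
  expand = solve 2 (λ t L → t :+ con 2 :* (con 2 :+ L) := t :+ L :+ L :+ con 4) refl t L

-- The construction

module Construction (t L K : ℕ) where

  m N : ℕ
  m = t + L + L
  N = binomial m L

  Word : Set
  Word = Fin (K ^ N)

  D : Fin N → Subset m
  D = lookup (subsetsOfSize m L)

  digit : Word → Fin N → Fin K
  digit = finToFun

  wordPart : Fin N → Word → Word → Subset (K ^ N)
  wordPart p x y with digit x p ≟ᶠ digit y p
  ... | yes _ = ⁅ x ⁆
  ... | no _  = ⁅ x ⁆ ∪ ⁅ y ⁆

  edge : Fin N → Word → Word → Subset (K ^ N + m)
  edge p x y = wordPart p x y ++ ∁ (D p)

  edgeAt : Fin N × Word × Word → Subset (K ^ N + m)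
  edgeAt (p , x , y) = edge p x y

  H : Hypergraph (K ^ N + m)
  H = mkHypergraph ⊤ (List.map edgeAt (cartesianProduct (allFin N) (cartesianProduct (allFin _) (allFin _))))

  data IsEdge : Subset (K ^ N + m) → Set where
    isEdge : ∀ p x y → IsEdge (edge p x y)

  ∈-edges⁺ : ∀ p x y → edge p x y ∈ₗ edges H
  ∈-edges⁺ p x y =
    ∈-map⁺ edgeAt (∈-cartesianProduct⁺ (∈-allFin p) (∈-cartesianProduct⁺ (∈-allFin x) (∈-allFin y)))

  ∈-edges⁻ : ∀ {e} → e ∈ₗ edges H → IsEdge e
  ∈-edges⁻ e∈ with (p , x , y) , _ , refl ← ∈-map⁻ edgeAt e∈ = isEdge p x y

  wellFormed : WellFormed H
  wellFormed = All.tabulate (λ _ _ → ∈⊤)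

  x∈wordPart : ∀ p x y → x ∈ wordPart p x y
  x∈wordPart p x y with digit x p ≟ᶠ digit y p
  ... | yes _ = x∈⁅x⁆ x
  ... | no _  = x∈p∪q⁺ (inj₁ (x∈⁅x⁆ x))

  y∈wordPart : ∀ {p x y} → digit x p ≢ digit y p → y ∈ wordPart p x y
  y∈wordPart {p} {x} {y} differ with digit x p ≟ᶠ digit y p
  ... | yes same = contradiction same differ
  ... | no _     = x∈p∪q⁺ (inj₂ (x∈⁅x⁆ y))

  wordPart-separated : ∀ {p x y u v} → u ∈ wordPart p x y → v ∈ wordPart p x y →
    digit u p ≡ digit v p → u ≡ v
  wordPart-separated {p} {x} {y} u∈ v∈ same with digit x p ≟ᶠ digit y p
  ... | yes _ = trans (x∈⁅y⁆⇒x≡y x u∈) (sym (x∈⁅y⁆⇒x≡y x v∈))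
  ... | no differ with x∈⁅y⁆∪⁅z⁆⇒x≡y⊎x≡z u∈ | x∈⁅y⁆∪⁅z⁆⇒x≡y⊎x≡z v∈
  ...   | inj₁ refl | inj₁ refl = refl
  ...   | inj₂ refl | inj₂ refl = refl
  ...   | inj₁ refl | inj₂ refl = contradiction same differ
  ...   | inj₂ refl | inj₁ refl = contradiction (sym same) differ

  ∣wordPart∣≤2 : ∀ p x y → ∣ wordPart p x y ∣ ≤ 2
  ∣wordPart∣≤2 p x y with digit x p ≟ᶠ digit y p
  ... | yes _ = ≤-trans (≤-reflexive (∣⁅x⁆∣≡1 x)) (n≤1+n 1)
  ... | no _  = ≤-trans (∣p∪q∣≤∣p∣+∣q∣ ⁅ x ⁆ ⁅ y ⁆) (≤-reflexive (cong₂ _+_ (∣⁅x⁆∣≡1 x) (∣⁅x⁆∣≡1 y)))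

  ∣D∣ : ∀ p → ∣ D p ∣ ≡ L
  ∣D∣ = VecAllₚ.lookup⁺ (∣subsetsOfSize∣ m L)

  ∣∁D∣ : ∀ p → ∣ ∁ (D p) ∣ ≡ t + L
  ∣∁D∣ p = trans (∣∁p∣≡n∸∣p∣ (D p)) (trans (cong (m ∸_) (∣D∣ p)) (m+n∸n≡m (t + L) L))

  ∣edge∣≤ : ∀ p x y → ∣ edge p x y ∣ ≤ t + (2 + L)
  ∣edge∣≤ p x y = begin
    ∣ edge p x y ∣                         ≡⟨ ∣++∣ (wordPart p x y) (∁ (D p)) ⟩
    (∣ wordPart p x y ∣) + (∣ ∁ (D p) ∣)   ≤⟨ +-mono-≤ (∣wordPart∣≤2 p x y) (≤-reflexive (∣∁D∣ p)) ⟩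
    2 + (t + L)                            ≡⟨ trans (+-suc t (suc L)) (cong suc (+-suc t L)) ⟨
    t + (2 + L)                            ∎
    where open ≤-Reasoning

  m∸[L+L]≡t : m ∸ (L + L) ≡ t
  m∸[L+L]≡t = trans (cong (_∸ (L + L)) (+-assoc t L L)) (m+n∸n≡m t (L + L))

  intersecting : Intersecting t H
  intersecting e₁ e₂ e₁∈ e₂∈ with ∈-edges⁻ e₁∈ | ∈-edges⁻ e₂∈
  ... | isEdge p x y | isEdge p′ x′ y′ = begin
    t                                               ≡⟨ m∸[L+L]≡t ⟨
    m ∸ (L + L)                                     ≡⟨ cong (m ∸_) (cong₂ _+_ (∣D∣ p) (∣D∣ p′)) ⟨
    m ∸ ((∣ D p ∣) + (∣ D p′ ∣))                    ≤⟨ n∸[∣p∣+∣q∣]≤∣∁p∩∁q∣ (D p) (D p′) ⟩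
    ∣ ∁ (D p) ∩ ∁ (D p′) ∣                          ≤⟨ m≤n+m _ _ ⟩
    (∣ W ∩ W′ ∣) + (∣ ∁ (D p) ∩ ∁ (D p′) ∣)         ≡⟨ ∣++∣ (W ∩ W′) (∁ (D p) ∩ ∁ (D p′)) ⟨
    ∣ (W ∩ W′) ++ (∁ (D p) ∩ ∁ (D p′)) ∣            ≡⟨ cong ∣_∣ (++-∩ W W′ (∁ (D p)) (∁ (D p′))) ⟨
    ∣ edge p x y ∩ edge p′ x′ y′ ∣                  ∎
    where
    open ≤-Reasoning
    W = wordPart p x y
    W′ = wordPart p′ x′ y′

  avoiding : 1 ≤ t → ∀ i j → ∃[ p ] i ∉ D p × j ∉ D p
  avoiding 1≤t i j = VecAny.index found , i∉ , j∉
    where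
    open ≤-Reasoning
    found : VecAny.Any (_⊆ ∁ ⁅ i ⁆ ∩ ∁ ⁅ j ⁆) (subsetsOfSize m L)
    found = subsetsOfSize-complete (begin
      L                                  ≤⟨ L≤t+L+L∸2 L 1≤t ⟩
      m ∸ 2                              ≡⟨ cong (m ∸_) (cong₂ _+_ (∣⁅x⁆∣≡1 i) (∣⁅x⁆∣≡1 j)) ⟨
      m ∸ ((∣ ⁅ i ⁆ ∣) + (∣ ⁅ j ⁆ ∣))    ≤⟨ n∸[∣p∣+∣q∣]≤∣∁p∩∁q∣ ⁅ i ⁆ ⁅ j ⁆ ⟩
      ∣ ∁ ⁅ i ⁆ ∩ ∁ ⁅ j ⁆ ∣              ∎)
    Dp⊆ : D (VecAny.index found) ⊆ ∁ ⁅ i ⁆ ∩ ∁ ⁅ j ⁆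
    Dp⊆ = VecAnyₚ.lookup-index found
    i∉ : i ∉ D (VecAny.index found)
    i∉ i∈ = x∈∁p⇒x∉p (proj₁ (x∈p∩q⁻ _ _ (Dp⊆ i∈))) (x∈⁅x⁆ i)
    j∉ : j ∉ D (VecAny.index found)
    j∉ j∈ = x∈∁p⇒x∉p (proj₂ (x∈p∩q⁻ _ _ (Dp⊆ j∈))) (x∈⁅x⁆ j)

  word∈edge : ∀ {p x y u} → u ∈ wordPart p x y → (u ↑ˡ m) ∈ edge p x y
  word∈edge = ↑ˡ∈++⁺

  core∈edge : ∀ {p x y j} → j ∉ D p → (K ^ N ↑ʳ j) ∈ edge p x y
  core∈edge j∉ = ↑ʳ∈++⁺ (x∉p⇒x∈∁p j∉)

  someWord : 1 ≤ K → Word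
  someWord 1≤K = fromℕ< (m^n>0 K {{>-nonZero 1≤K}} N)

  covers : 1 ≤ t → 1 ≤ K → CoversPairs (edges H)
  covers 1≤t 1≤K {u} {v} u≢v with split (K ^ N) m u | split (K ^ N) m v
  ... | left x | left y =
    let p , differ = finToFun-≢ (u≢v ∘ cong (_↑ˡ m)) in
    edge p x y , ∈-edges⁺ p x y , word∈edge (x∈wordPart p x y) , word∈edge (y∈wordPart differ)
  ... | left x | right j =
    let p , j∉ , _ = avoiding 1≤t j j in
    edge p x x , ∈-edges⁺ p x x , word∈edge (x∈wordPart p x x) , core∈edge j∉
  ... | right j | left x =
    let p , j∉ , _ = avoiding 1≤t j j in
    edge p x x , ∈-edges⁺ p x x , core∈edge j∉ , word∈edge (x∈wordPart p x x)
  ... | right i | right j =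
    let p , i∉ , j∉ = avoiding 1≤t i j
        w = someWord 1≤K
    in edge p w w , ∈-edges⁺ p w w , core∈edge i∉ , core∈edge j∉

  isChi : 1 ≤ t → 1 ≤ K → IsChi H (t + (2 + L)) (K ^ N + m)
  isChi 1≤t 1≤K = isChi-covering (edges H) small (covers 1≤t 1≤K)
    where
    small : ∀ {e} → e ∈ₗ edges H → ∣ e ∣ ≤ t + (2 + L)
    small e∈ with isEdge p x y ← ∈-edges⁻ e∈ = ∣edge∣≤ p x y

  B b : ℕ
  B = binomial (L + L) L
  b = K ^ B + (L + L)

  2+[L+L]≤b : 2 ≤ K → 2 + (L + L) ≤ b
  2+[L+L]≤b 2≤K = +-monoˡ-≤ (L + L) (≤-trans 2≤K (≤-trans (≤-reflexive (sym (*-identityʳ K))) K≤K^B))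
    where
    K≤K^B : K ^ 1 ≤ K ^ B
    K≤K^B = ^-monoʳ-≤ K {{>-nonZero (≤-trans (s≤s z≤n) 2≤K)}} (0<binomial (m≤m+n L L))

  GoodLinkColouring : Subset (K ^ N + m) → Set
  GoodLinkColouring S = ∃[ g ] Strong (link H S) (2 + L) g × numColours (link H S) g ≤ b

  ∣∁SC∣≡ : ∀ {s} (SC : Subset m) → s + ∣ SC ∣ ≡ t → ∣ ∁ SC ∣ ≡ s + (L + L)
  ∣∁SC∣≡ {s} SC s+∣SC∣≡t = begin
    ∣ ∁ SC ∣               ≡⟨ ∣∁p∣≡n∸∣p∣ SC ⟩
    t + L + L ∸ c          ≡⟨ cong (λ t → t + L + L ∸ c) s+∣SC∣≡t ⟨
    s + c + L + L ∸ c      ≡⟨ cong (_∸ c) (+-assoc (s + c) L L) ⟩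
    s + c + (L + L) ∸ c    ≡⟨ cong (λ r → r + (L + L) ∸ c) (+-comm s c) ⟩
    c + s + (L + L) ∸ c    ≡⟨ cong (_∸ c) (+-assoc c s (L + L)) ⟩
    c + (s + (L + L)) ∸ c  ≡⟨ m+n∸m≡n c (s + (L + L)) ⟩
    s + (L + L)            ∎
    where
    open ≡-Reasoning
    c = ∣ SC ∣

  ∣wordPart─SW∣≤2∸∣SW∣ : ∀ {p x y} {SW : Subset (K ^ N)} →
    SW ⊆ wordPart p x y → ∣ wordPart p x y ─ SW ∣ ≤ 2 ∸ ∣ SW ∣
  ∣wordPart─SW∣≤2∸∣SW∣ {p} {x} {y} SW⊆ =
    m+n≤o⇒m≤o∸n _ (subst (_≤ 2) (sym (∣p─q∣+∣q∣≡∣p∣ SW⊆)) (∣wordPart∣≤2 p x y))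

  -- The bound m ≤ a u keeps word colours apart from the core colours toℕ j < m.
  ValidOnWords : Subset (K ^ N) → Subset m → Colouring (K ^ N) → Set
  ValidOnWords SW SC a = ∀ {p x y} → SW ⊆ wordPart p x y → SC ⊆ ∁ (D p) →
    InjectiveOn a (wordPart p x y ─ SW) × (∀ {u} → u ∈ wordPart p x y ─ SW → m ≤ a u)

  strong-⊕toℕ : ∀ {SW : Subset (K ^ N)} {SC : Subset m} (a : Colouring (K ^ N)) → ValidOnWords SW SC a →
    Strong (link H (SW ++ SC)) (2 + L) (a ⊕ toℕ)
  strong-⊕toℕ {SW} {SC} a valid = link-strong H injective
    where
    injective : ∀ {e} → e ∈ₗ edges H → SW ++ SC ⊆ e → InjectiveOn (a ⊕ toℕ) (e ─ (SW ++ SC))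
    injective e∈ S⊆e with isEdge p x y ← ∈-edges⁻ e∈ =
      let SW⊆ , SC⊆ = ⊆-++⁻ S⊆e
          a-injective , m≤a = valid SW⊆ SC⊆
      in subst (InjectiveOn (a ⊕ toℕ)) (sym (++-─ (wordPart p x y) SW (∁ (D p)) SC))
           (⊕-injectiveOn a toℕ a-injective (λ _ _ → toℕ-injective)
             (λ {_} {j} u∈ _ au≡j → <⇒≢ (<-≤-trans (toℕ<n j) (m≤a u∈)) (sym au≡j)))

  numColours-⊕toℕ : ∀ {SW : Subset (K ^ N)} {SC : Subset m} (a : Colouring (K ^ N)) (Y : List ℕ) →
    (∀ x → a x ∈ₗ List.map toℕ (elems (∁ SC)) List.++ Y) →
    numColours (link H (SW ++ SC)) (a ⊕ toℕ) ≤ ∣ ∁ SC ∣ + length Y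
  numColours-⊕toℕ {SW} {SC} a Y a∈ =
    ≤-trans (coloursOn-⊕≤length a toℕ _ (λ {x} _ → a∈ x) core∈) (≤-reflexive length-colours)
    where
    colours = List.map toℕ (elems (∁ SC)) List.++ Y
    core∈ : ∀ {j} → (K ^ N ↑ʳ j) ∈ ⊤ ─ (SW ++ SC) → toℕ j ∈ₗ colours
    core∈ j∈ = ∈-++⁺ˡ (∈-map⁺ toℕ (∈-elems⁺ (x∉p⇒x∈∁p (x∈p─q⇒x∉q ⊤ (SW ++ SC) j∈ ∘ ↑ʳ∈++⁺))))
    length-colours : length colours ≡ ∣ ∁ SC ∣ + length Y
    length-colours =
      trans (length-++ (List.map toℕ (elems (∁ SC)))) (cong (_+ length Y) (length-image toℕ (∁ SC)))

  -- Only positions p with D p ⊆ ∁ SC occur in link edges.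
  colouringWithoutWords : ∀ {SW : Subset (K ^ N)} {SC : Subset m} → ∣ SC ∣ ≡ t → GoodLinkColouring (SW ++ SC)
  colouringWithoutWords {SW} {SC} ∣SC∣≡t = a ⊕ toℕ , strong-⊕toℕ a valid , few
    where
    Q : Subset N
    Q = positionsWithin (∁ SC) (subsetsOfSize m L)
    a : Colouring (K ^ N)
    a x = m + toℕ (encodeOn Q (digit x))
    valid : ValidOnWords SW SC a
    valid {p} _ SC⊆∁Dp = injective , λ _ → m≤m+n m _
      where
      p∈Q : p ∈ Q
      p∈Q = ∈-positionsWithin⁺ (subsetsOfSize m L)
        (λ i∈Dp → x∉p⇒x∈∁p (λ i∈SC → x∈∁p⇒x∉p (SC⊆∁Dp i∈SC) i∈Dp))
      injective : InjectiveOn a (wordPart p _ _ ─ SW)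
      injective u∈ v∈ au≡av = wordPart-separated (p─q⊆p _ _ u∈) (p─q⊆p _ _ v∈)
        (encodeOn-injective (toℕ-injective (+-cancelˡ-≡ m _ _ au≡av)) p∈Q)
    ∣∁SC∣≡L+L : ∣ ∁ SC ∣ ≡ L + L
    ∣∁SC∣≡L+L = ∣∁SC∣≡ SC ∣SC∣≡t
    ∣Q∣≡B : ∣ Q ∣ ≡ B
    ∣Q∣≡B = trans (∣positionsWithin∣ m L (∁ SC)) (cong (λ r → binomial r L) ∣∁SC∣≡L+L)
    codes : List ℕ
    codes = applyUpTo (m +_) (K ^ ∣ Q ∣)
    few : numColours (link H (SW ++ SC)) (a ⊕ toℕ) ≤ b
    few = begin
      numColours (link H (SW ++ SC)) (a ⊕ toℕ)
        ≤⟨ numColours-⊕toℕ {SW} {SC} a codes (λ _ → ∈-++⁺ʳ _ (∈-applyUpTo⁺ (m +_) (toℕ<n _))) ⟩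
      (∣ ∁ SC ∣) + length codes
        ≡⟨ cong₂ _+_ ∣∁SC∣≡L+L (trans (length-applyUpTo (m +_) (K ^ ∣ Q ∣)) (cong (K ^_) ∣Q∣≡B)) ⟩
      L + L + K ^ B
        ≡⟨ +-comm (L + L) (K ^ B) ⟩
      b ∎
      where open ≤-Reasoning

  colouringWithOneWord : ∀ {SW : Subset (K ^ N)} {SC : Subset m} → 2 ≤ K → ∣ SW ∣ ≡ 1 → 1 + ∣ SC ∣ ≡ t →
    GoodLinkColouring (SW ++ SC)
  colouringWithOneWord {SW} {SC} 2≤K ∣SW∣≡1 1+∣SC∣≡t = a ⊕ toℕ , strong-⊕toℕ a valid , few
    where
    a : Colouring (K ^ N)
    a _ = m
    valid : ValidOnWords SW SC a
    valid {p} {x} {y} SW⊆ _ = (λ u∈ v∈ _ → ∣p∣≤1⇒x≡y ∣W─SW∣≤1 u∈ v∈) , λ _ → ≤-refl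
      where
      ∣W─SW∣≤1 : ∣ wordPart p x y ─ SW ∣ ≤ 1
      ∣W─SW∣≤1 = subst (λ s → ∣ wordPart p x y ─ SW ∣ ≤ 2 ∸ s) ∣SW∣≡1 (∣wordPart─SW∣≤2∸∣SW∣ SW⊆)
    few : numColours (link H (SW ++ SC)) (a ⊕ toℕ) ≤ b
    few = begin
      numColours (link H (SW ++ SC)) (a ⊕ toℕ)
        ≤⟨ numColours-⊕toℕ {SW} {SC} a (m ∷ []) (λ _ → ∈-++⁺ʳ _ (here refl)) ⟩
      (∣ ∁ SC ∣) + 1
        ≡⟨ cong (_+ 1) (∣∁SC∣≡ SC 1+∣SC∣≡t) ⟩
      1 + (L + L) + 1
        ≡⟨ +-comm (1 + (L + L)) 1 ⟩
      2 + (L + L)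
        ≤⟨ 2+[L+L]≤b 2≤K ⟩
      b ∎
      where open ≤-Reasoning

  -- No word survives in a link edge, so the words may share the colour of a core vertex c₀ ∉ SC.
  colouringWithTwoWords : ∀ {SW : Subset (K ^ N)} {SC : Subset m} → 2 ≤ K → ∣ SW ∣ ≡ 2 → 2 + ∣ SC ∣ ≡ t →
    GoodLinkColouring (SW ++ SC)
  colouringWithTwoWords {SW} {SC} 2≤K ∣SW∣≡2 2+∣SC∣≡t = a ⊕ toℕ , strong-⊕toℕ a valid , few
    where
    ∣∁SC∣≡2+[L+L] : ∣ ∁ SC ∣ ≡ 2 + (L + L)
    ∣∁SC∣≡2+[L+L] = ∣∁SC∣≡ SC 2+∣SC∣≡t
    c₀∈∁SC : Nonempty (∁ SC)
    c₀∈∁SC = 0<∣p∣⇒nonempty (subst (0 <_) (sym ∣∁SC∣≡2+[L+L]) (s≤s z≤n))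
    a : Colouring (K ^ N)
    a _ = toℕ (proj₁ c₀∈∁SC)
    valid : ValidOnWords SW SC a
    valid {p} {x} {y} SW⊆ _ = (λ u∈ _ _ → noWord u∈) , noWord
      where
      ∣W─SW∣≤0 : ∣ wordPart p x y ─ SW ∣ ≤ 0
      ∣W─SW∣≤0 = subst (λ s → ∣ wordPart p x y ─ SW ∣ ≤ 2 ∸ s) ∣SW∣≡2 (∣wordPart─SW∣≤2∸∣SW∣ SW⊆)
      noWord : ∀ {u} {A : Set} → u ∈ wordPart p x y ─ SW → A
      noWord u∈ = contradiction ∣W─SW∣≤0 (<⇒≱ (x∈p⇒0<∣p∣ u∈))
    few : numColours (link H (SW ++ SC)) (a ⊕ toℕ) ≤ b
    few = begin
      numColours (link H (SW ++ SC)) (a ⊕ toℕ)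
        ≤⟨ numColours-⊕toℕ {SW} {SC} a [] (λ _ → ∈-++⁺ˡ (∈-map⁺ toℕ (∈-elems⁺ (proj₂ c₀∈∁SC)))) ⟩
      (∣ ∁ SC ∣) + 0
        ≡⟨ trans (+-identityʳ _) ∣∁SC∣≡2+[L+L] ⟩
      2 + (L + L)
        ≤⟨ 2+[L+L]≤b 2≤K ⟩
      b ∎
      where open ≤-Reasoning

  colouringWithManyWords : ∀ {SW : Subset (K ^ N)} {SC : Subset m} → 2 ≤ K → 3 ≤ ∣ SW ∣ →
    GoodLinkColouring (SW ++ SC)
  colouringWithManyWords {SW} {SC} 2≤K 3≤∣SW∣ = (λ _ → 0) , link-strong H noEdge , few
    where
    noEdge : ∀ {e} → e ∈ₗ edges H → SW ++ SC ⊆ e → InjectiveOn (λ _ → 0) (e ─ (SW ++ SC))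
    noEdge e∈ S⊆e with isEdge p x y ← ∈-edges⁻ e∈ =
      let SW⊆ , _ = ⊆-++⁻ {A = SW} {A′ = wordPart p x y} S⊆e
      in contradiction (≤-trans (p⊆q⇒∣p∣≤∣q∣ SW⊆) (∣wordPart∣≤2 p x y)) (<⇒≱ 3≤∣SW∣)
    few : numColours (link H (SW ++ SC)) (λ _ → 0) ≤ b
    few = ≤-trans (coloursOn≤length (λ _ → 0) {verts (link H (SW ++ SC))} (0 ∷ []) (λ _ → here refl))
                  (≤-trans (s≤s z≤n) (2+[L+L]≤b 2≤K))

  goodLinkColouring : 2 ≤ K → ∀ (SW : Subset (K ^ N)) (SC : Subset m) → ∣ SW ∣ + ∣ SC ∣ ≡ t →
    GoodLinkColouring (SW ++ SC)
  goodLinkColouring 2≤K SW SC sizes with ∣ SW ∣ in ∣SW∣≡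
  ... | 0 = colouringWithoutWords {SW} sizes
  ... | 1 = colouringWithOneWord {SW} 2≤K ∣SW∣≡ sizes
  ... | 2 = colouringWithTwoWords {SW} 2≤K ∣SW∣≡ sizes
  ... | suc (suc (suc _)) =
    colouringWithManyWords {SW} {SC} 2≤K (≤-trans (s≤s (s≤s (s≤s z≤n))) (≤-reflexive (sym ∣SW∣≡)))

  chiLinkLe : 2 ≤ K → ChiLinkLe H t (2 + L) b
  chiLinkLe 2≤K = chiLinkLe-intro H (≤-trans (s≤s z≤n) (2+[L+L]≤b 2≤K)) colouring
    where
    colouring : ∀ S → ∣ S ∣ ≡ t → GoodLinkColouring S
    colouring S ∣S∣≡t with SW , SC , refl ← Vec.splitAt (K ^ N) S =
      goodLinkColouring 2≤K SW SC (trans (sym (∣++∣ SW SC)) ∣S∣≡t)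

theorem4p2 : (t ℓ K : ℕ) → 1 ≤ t → 2 ≤ ℓ → 2 ≤ K →
    Σ ℕ (λ n → Σ (Hypergraph n) (λ H →
    WellFormed H
    × Intersecting t H
    × IsChi H (t + ℓ) (K ^ ((t + 2 * ℓ ∸ 4) C (ℓ ∸ 2)) + (t + 2 * ℓ ∸ 4))
    × ChiLinkLe H t ℓ (K ^ ((2 * ℓ ∸ 4) C (ℓ ∸ 2)) + (2 * ℓ ∸ 4))))
theorem4p2 t 0 K _ () _
theorem4p2 t 1 K _ (s≤s ()) _
theorem4p2 t (suc (suc L)) K 1≤t _ 2≤K =
  _ , H , wellFormed , intersecting ,
  subst (IsChi H (t + suc (suc L))) (size≡ (t+L+L≡t+2*[2+L]∸4 t L)) (isChi 1≤t (≤-trans (s≤s z≤n) 2≤K)) ,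
  subst (ChiLinkLe H t (suc (suc L))) (size≡ (t+L+L≡t+2*[2+L]∸4 0 L)) (chiLinkLe 2≤K)
  where
  open Construction t L K
  size≡ : ∀ {a c} → a ≡ c → K ^ binomial a L + a ≡ K ^ (c C L) + c
  size≡ {a} refl = cong (λ r → K ^ r + a) (binomial≡C a L)
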